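{- Let $G$ be a finite group. If $rc(\Gamma_G^e)=2$, then for every ordering $x_1,\dots,x_m$ of an essential cyclic set $Max_G$ there exists an awning.
   Context: Let $G$ be a finite group. The enhanced power graph $\Gamma_G^e$ has vertex set $G$, two distinct vertices $x,y$ being adjacent iff $x,y\in\langle z\rangle$ for some $z\in G$. For a connected graph $\Gamma$, an edge-colouring $\zeta:E(\Gamma)\to\{1,\dots,k\}$ (not necessarily proper) is a rainbow $k$-colouring if every pair of distinct vertices is joined by a path whose edges have pairwise distinct colours; $rc(\Gamma)$ is the minimum such $k$. An essential cyclic set $Max_G=\{x_1,\dots,x_m\}$ is a set of elements of $G$ such that $\langle x_1\rangle,\dots,\langle x_m\rangle$ are pairwise distinct and are exactly the maximal cyclic subgroups of $G$. Awning: given an ordering $x_1,\dots,x_m$ of $Max_G$, an awning is a family of indexed sets $H_1,\dots,H_{m-1}$, where $H_i=\{h_{i,i+1},\dots,h_{i,m}\}\subseteq\langle x_i\rangle$ is partitioned as $H_i=A_i\,\dot\cup\,B_i$, such that (1) $h_{i,j}\in\langle x_i\rangle\cap\langle x_j\rangle$ for all $i<j$; (2) whenever $i<j$, $2\le j\le m-1$, $s\in\{j+1,\dots,m\}$, $r\in\{i+1,\dots,m\}$ and $h_{j,s}=h_{i,r}$: (a) if $r=j$ and $h_{i,r}\in A_i$ then $h_{j,s}\in B_j$; (b) if $r=j$ and $h_{i,r}\in B_i$ then $h_{j,s}\in A_j$; (c) if $r=s>j$ and $h_{i,r}\in A_i$ then $h_{j,r}\in A_j$; (d) if $r=s>j$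 and $h_{i,r}\in B_i$ then $h_{j,r}\in B_j$. -}

module Defs where

open import Level using (0ℓ)
open import Data.Nat using (ℕ; zero; suc; _<_)
open import Data.Integer using (ℤ; +_; -[1+_])
open import Data.Fin using (Fin; toℕ)
open import Data.Bool using (Bool; true; false)
open import Data.List using (List; []; _∷_)
open import Data.List.Relation.Unary.Unique.Propositional using (Unique)
open import Data.Product using (Σ; ∃; _×_; _,_)
open import Relation.Nullary using (¬_)
open import Relation.Binary.PropositionalEquality using (_≡_; _≢_)
open import Algebra.Structures using (IsGroup)

-- A finite group, presented (up to isomorphism) on the carrier Fin order,
-- with propositional equality as the group equality.
record FiniteGroup : Set where
  field
    order   : ℕ
    _∙_     : Fin order → Fin order → Fin order
    ε       : Fin order
    _⁻¹     : Fin order → Fin order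
    isGroup : IsGroup _≡_ _∙_ ε _⁻¹

module _ (G : FiniteGroup) where
  open FiniteGroup G

  El : Set
  El = Fin order

  powℕ : El → ℕ → El
  powℕ x zero    = ε
  powℕ x (suc k) = x ∙ powℕ x k

  pow : El → ℤ → El
  pow x (+ k)      = powℕ x k
  pow x -[1+ k ]   = (powℕ x (suc k)) ⁻¹

  _∈⟨_⟩ : El → El → Set
  y ∈⟨ x ⟩ = ∃ λ (k : ℤ) → y ≡ pow x k

  _⊆C_ : El → El → Set
  x ⊆C z = ∀ g → g ∈⟨ x ⟩ → g ∈⟨ z ⟩

  _≡C_ : El → El → Set
  x ≡C z = (x ⊆C z) × (z ⊆C x)

  MaximalCyclic : El → Set
  MaximalCyclic x = ∀ z → x ⊆C z → x ≡C z

  -- Enhanced power graph: distinct x, y adjacent iff both lie in some ⟨z⟩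
  Adj : El → El → Set
  Adj x y = (x ≢ y) × (∃ λ z → (x ∈⟨ z ⟩) × (y ∈⟨ z ⟩))

  -- Edge colourings with colours Fin k ({1,…,k}): a colour for every edge,
  -- independent of the orientation (and of the adjacency witness).
  record EdgeColouring (k : ℕ) : Set where
    field
      colour    : (x y : El) → Adj x y → Fin k
      symmetric : ∀ x y (p : Adj x y) (q : Adj y x) → colour x y p ≡ colour y x q

  data Walk : El → El → Set where
    [] : ∀ {v} → Walk v v
    step : ∀ {u w v} → Adj u w → Walk w v → Walk u v

  vertices : ∀ {u v} → Walk u v → List El
  vertices {u} []         = u ∷ []
  vertices {u} (step _ w) = u ∷ vertices w

  colours : ∀ {k u v} → EdgeColouring k → Walk u v → List (Fin k)
  colours c []                     = []
  colours c (step {u} {w} p rest) =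
    EdgeColouring.colour c u w p ∷ colours c rest

  RainbowPath : ∀ {k} → EdgeColouring k → El → El → Set
  RainbowPath c u v =
    Σ (Walk u v) λ w → Unique (vertices w) × Unique (colours c w)

  IsRainbowColouring : ∀ {k} → EdgeColouring k → Set
  IsRainbowColouring c = ∀ u v → u ≢ v → RainbowPath c u v

  RainbowColourable : ℕ → Set
  RainbowColourable k = Σ (EdgeColouring k) IsRainbowColouring

  rcEq : ℕ → Set
  rcEq k = RainbowColourable k × (∀ j → j < k → ¬ RainbowColourable j)

  IsEssentialCyclicOrdering : (m : ℕ) → (Fin m → El) → Set
  IsEssentialCyclicOrdering m x =
    (∀ i j → i ≢ j → ¬ (x i ≡C x j))
    × (∀ i → MaximalCyclic (x i))
    × (∀ z → MaximalCyclic z → ∃ λ i → z ≡C x i)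

  -- An awning for the ordering x (indices 0-based: Fin m).
  -- h i j plays h_{i,j} (only used for i < j); the partition H_i = A_i ∪̇ B_i
  -- is given by side i : El → Bool, A_i = {g ∈ H_i | side i g ≡ true},
  -- B_i = {g ∈ H_i | side i g ≡ false}.
  record Awning (m : ℕ) (x : Fin m → El) : Set where
    field
      h    : Fin m → Fin m → El
      side : Fin m → El → Bool
      cond1 : ∀ i j → toℕ i < toℕ j → (h i j ∈⟨ x i ⟩) × (h i j ∈⟨ x j ⟩)
      -- condition (2); the constraints 2 ≤ j ≤ m-1 (1-based) are implied by
      -- i < j < s, but are kept implicit in these inequalities.
      cond2a : ∀ i j s → toℕ i < toℕ j → toℕ j < toℕ s →
               h j s ≡ h i j → side i (h i j) ≡ true → side j (h j s) ≡ false
      cond2b : ∀ i j s → toℕ i < toℕ j → toℕ j < toℕ s →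
               h j s ≡ h i j → side i (h i j) ≡ false → side j (h j s) ≡ true
      cond2c : ∀ i j r → toℕ i < toℕ j → toℕ j < toℕ r →
               h j r ≡ h i r → side i (h i r) ≡ true → side j (h j r) ≡ true
      cond2d : ∀ i j r → toℕ i < toℕ j → toℕ j < toℕ r →
               h j r ≡ h i r → side i (h i r) ≡ false → side j (h j r) ≡ false

-- Distinct generators x_i, x_j of distinct maximal cyclic subgroups
-- are not adjacent in Γ_G^e, so in a rainbow 2-colouring they are joined by
-- a rainbow path of length exactly two:  x_i — g — x_j  with the two edges
-- coloured differently (a longer path would need three distinct colours).
-- We take h_{i,j} := g, and put g into A_i or B_i according to the colour of
-- the edge x_i — g.  Since a neighbour of a maximal-cyclic generator x lies
-- in ⟨x⟩, condition (1) holds.  Condition (2) is colour bookkeeping with two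
-- colours: in (a)/(b) the edge x_j — h_{j,s} is the edge h_{i,j} — x_j, whose
-- colour differs from that of x_i — h_{i,j}; in (c)/(d) the edges x_i — g and
-- x_j — g both differ in colour from the common edge g — x_r, hence agree.
module Submission where

open import Defs
open import Data.Nat using (ℕ; zero; suc; _<_)
open import Data.Nat.Properties using (<-trans; _<?_)
open import Data.Fin using (Fin; toℕ; _≟_)
import Data.Fin as F
open import Data.Fin.Properties using (any?; <⇒≢)
open import Data.Integer using (+_; -[1+_])
open import Data.Bool using (Bool; true; false; not)
open import Data.List.Relation.Unary.All using (_∷_)
open import Data.List.Relation.Unary.AllPairs using (_∷_)
open import Data.Product using (∃; _,_; proj₁; proj₂)
open import Data.Empty using (⊥-elim)
open import Relation.Nullary using (¬_; yes; no)
open import Relation.Nullary.Decidable using (_×-dec_)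
open import Relation.Binary.PropositionalEquality
  using (_≡_; _≢_; refl; sym; trans; cong; module ≡-Reasoning)
open import Algebra.Structures using (IsGroup)
open import Algebra.Bundles using (Group)
import Algebra.Properties.Group as GroupProperties

module CyclicSubgroup (G : FiniteGroup) where
  open FiniteGroup G renaming (_∙_ to infixl 7 _∙_; _⁻¹ to infix 8 _⁻¹)
  open IsGroup isGroup using (assoc; identityˡ; identityʳ; inverseˡ; inverseʳ)
  open ≡-Reasoning

  asGroup : Group _ _
  asGroup = record { _≈_ = _≡_ ; _∙_ = _∙_ ; ε = ε ; _⁻¹ = _⁻¹ ; isGroup = isGroup }

  open GroupProperties asGroup using (ε⁻¹≈ε; ⁻¹-involutive; ⁻¹-anti-homo-∙)

  infix 4 _∈⟪_⟫
  _∈⟪_⟫ : El G → El G → Set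
  g ∈⟪ z ⟫ = _∈⟨_⟩ G g z

  ∈-resp-≡ : ∀ {g g′ z} → g ≡ g′ → g ∈⟪ z ⟫ → g′ ∈⟪ z ⟫
  ∈-resp-≡ refl g∈ = g∈

  module _ (z : El G) where
    infixr 9 _^_
    _^_ : El G → ℕ → El G
    _^_ = powℕ G

    ^-comm : ∀ n → z ∙ z ^ n ≡ z ^ n ∙ z
    ^-comm zero    = trans (identityʳ z) (sym (identityˡ z))
    ^-comm (suc n) = begin
      z ∙ (z ∙ z ^ n)   ≡⟨ cong (z ∙_) (^-comm n) ⟩
      z ∙ (z ^ n ∙ z)   ≡⟨ sym (assoc z (z ^ n) z) ⟩
      (z ∙ z ^ n) ∙ z   ∎

    ^⁻¹-∈ : ∀ n → (z ^ n) ⁻¹ ∈⟪ z ⟫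
    ^⁻¹-∈ zero    = + 0 , ε⁻¹≈ε
    ^⁻¹-∈ (suc n) = -[1+ n ] , refl

    z∙-closed : ∀ {g} → g ∈⟪ z ⟫ → z ∙ g ∈⟪ z ⟫
    z∙-closed (+ n , refl)      = + suc n , refl
    z∙-closed (-[1+ n ] , refl) = ∈-resp-≡ (sym cancel) (^⁻¹-∈ n)
      where
      cancel : z ∙ (z ∙ z ^ n) ⁻¹ ≡ (z ^ n) ⁻¹
      cancel = begin
        z ∙ (z ∙ z ^ n) ⁻¹          ≡⟨ cong (λ t → z ∙ t ⁻¹) (^-comm n) ⟩
        z ∙ (z ^ n ∙ z) ⁻¹          ≡⟨ cong (z ∙_) (⁻¹-anti-homo-∙ (z ^ n) z) ⟩
        z ∙ (z ⁻¹ ∙ (z ^ n) ⁻¹)     ≡⟨ sym (assoc z (z ⁻¹) _) ⟩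
        (z ∙ z ⁻¹) ∙ (z ^ n) ⁻¹     ≡⟨ cong (_∙ (z ^ n) ⁻¹) (inverseʳ z) ⟩
        ε ∙ (z ^ n) ⁻¹              ≡⟨ identityˡ _ ⟩
        (z ^ n) ⁻¹                  ∎

    z⁻¹∙-closed : ∀ {g} → g ∈⟪ z ⟫ → z ⁻¹ ∙ g ∈⟪ z ⟫
    z⁻¹∙-closed (+ zero , refl)   = -[1+ 0 ] , (begin
      z ⁻¹ ∙ ε      ≡⟨ identityʳ _ ⟩
      z ⁻¹          ≡⟨ cong _⁻¹ (sym (identityʳ z)) ⟩
      (z ∙ ε) ⁻¹    ∎)
    z⁻¹∙-closed (+ suc n , refl)  = + n , (begin
      z ⁻¹ ∙ (z ∙ z ^ n)   ≡⟨ sym (assoc _ _ _) ⟩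
      (z ⁻¹ ∙ z) ∙ z ^ n   ≡⟨ cong (_∙ z ^ n) (inverseˡ z) ⟩
      ε ∙ z ^ n            ≡⟨ identityˡ _ ⟩
      z ^ n                ∎)
    z⁻¹∙-closed (-[1+ n ] , refl) = -[1+ suc n ] , (begin
      z ⁻¹ ∙ (z ∙ z ^ n) ⁻¹   ≡⟨ sym (⁻¹-anti-homo-∙ (z ∙ z ^ n) z) ⟩
      ((z ∙ z ^ n) ∙ z) ⁻¹    ≡⟨ cong _⁻¹ (assoc z (z ^ n) z) ⟩
      (z ∙ (z ^ n ∙ z)) ⁻¹    ≡⟨ cong (λ t → (z ∙ t) ⁻¹) (sym (^-comm n)) ⟩
      (z ∙ (z ∙ z ^ n)) ⁻¹    ∎)

    ^∙-closed : ∀ n {g} → g ∈⟪ z ⟫ → z ^ n ∙ g ∈⟪ z ⟫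
    ^∙-closed zero    g∈ = ∈-resp-≡ (sym (identityˡ _)) g∈
    ^∙-closed (suc n) g∈ = ∈-resp-≡ (sym (assoc z (z ^ n) _)) (z∙-closed (^∙-closed n g∈))

    ^⁻¹∙-closed : ∀ n {g} → g ∈⟪ z ⟫ → (z ^ n) ⁻¹ ∙ g ∈⟪ z ⟫
    ^⁻¹∙-closed zero {g} g∈ = ∈-resp-≡ (sym eq) g∈
      where
      eq : ε ⁻¹ ∙ g ≡ g
      eq = trans (cong (_∙ g) ε⁻¹≈ε) (identityˡ g)
    ^⁻¹∙-closed (suc n) {g} g∈ = ∈-resp-≡ eq (^⁻¹∙-closed n (z⁻¹∙-closed g∈))
      where
      eq : (z ^ n) ⁻¹ ∙ (z ⁻¹ ∙ g) ≡ (z ∙ z ^ n) ⁻¹ ∙ g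
      eq = begin
        (z ^ n) ⁻¹ ∙ (z ⁻¹ ∙ g)   ≡⟨ sym (assoc _ _ _) ⟩
        ((z ^ n) ⁻¹ ∙ z ⁻¹) ∙ g   ≡⟨ cong (_∙ g) (sym (⁻¹-anti-homo-∙ z (z ^ n))) ⟩
        (z ∙ z ^ n) ⁻¹ ∙ g        ∎

    ∙-closed : ∀ {a g} → a ∈⟪ z ⟫ → g ∈⟪ z ⟫ → a ∙ g ∈⟪ z ⟫
    ∙-closed (+ n , refl)      g∈ = ^∙-closed n g∈
    ∙-closed (-[1+ n ] , refl) g∈ = ^⁻¹∙-closed (suc n) g∈

    ⁻¹-closed : ∀ {a} → a ∈⟪ z ⟫ → a ⁻¹ ∈⟪ z ⟫
    ⁻¹-closed (+ n , refl)      = ^⁻¹-∈ n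
    ⁻¹-closed (-[1+ n ] , refl) = + suc n , ⁻¹-involutive _

    pow-closed : ∀ {a} → a ∈⟪ z ⟫ → ∀ k → pow G a k ∈⟪ z ⟫
    pow-closed {a} a∈ (+ n)      = powℕ-closed n
      where
      powℕ-closed : ∀ n → a ^ n ∈⟪ z ⟫
      powℕ-closed zero    = + 0 , refl
      powℕ-closed (suc n) = ∙-closed a∈ (powℕ-closed n)
    pow-closed a∈ -[1+ n ] = ⁻¹-closed (pow-closed a∈ (+ suc n))

  ∈⇒⊆C : ∀ {a z} → a ∈⟪ z ⟫ → _⊆C_ G a z
  ∈⇒⊆C {z = z} a∈ _ (k , refl) = pow-closed z a∈ k

module MaximalCyclicAdjacency (G : FiniteGroup) where
  open CyclicSubgroup G

  Adj-sym : ∀ {u v} → Adj G u v → Adj G v u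
  Adj-sym (u≢v , z , u∈ , v∈) = (λ v≡u → u≢v (sym v≡u)) , z , v∈ , u∈

  -- Every neighbour of a maximal-cyclic generator a lies in ⟨a⟩: the
  -- common cyclic subgroup containing both must equal ⟨a⟩.
  neighbour-∈ : ∀ {a g} → MaximalCyclic G a → Adj G a g → g ∈⟪ a ⟫
  neighbour-∈ a-max (_ , z , a∈ , g∈) = proj₂ (a-max z (∈⇒⊆C a∈)) _ g∈

  -- Generators of distinct maximal cyclic subgroups are not adjacent: both
  -- subgroups would equal the cyclic subgroup containing them.
  distinct-maximal-nonadjacent : ∀ {a b} → MaximalCyclic G a → MaximalCyclic G b →
                                 ¬ _≡C_ G a b → ¬ Adj G a b
  distinct-maximal-nonadjacent a-max b-max a≢b (_ , z , a∈ , b∈) =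
    let (a⊆z , z⊆a) = a-max z (∈⇒⊆C a∈)
        (b⊆z , z⊆b) = b-max z (∈⇒⊆C b∈)
    in a≢b ((λ g g∈ → z⊆b g (a⊆z g g∈)) , (λ g g∈ → z⊆a g (b⊆z g g∈)))

  distinct-cyclic-≢ : ∀ {a b} → ¬ _≡C_ G a b → a ≢ b
  distinct-cyclic-≢ a≢b refl = a≢b ((λ _ g∈ → g∈) , (λ _ g∈ → g∈))

module EdgeColours (G : FiniteGroup) {k : ℕ} (c : EdgeColouring G k) where
  open MaximalCyclicAdjacency G

  colour : ∀ {u v} → Adj G u v → Fin k
  colour {u} {v} = EdgeColouring.colour c u v

  colour-flip : ∀ {u v} (p : Adj G u v) (q : Adj G v u) → colour p ≡ colour q
  colour-flip = EdgeColouring.symmetric c _ _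

  colour-cong : ∀ {u u′ v v′} → u ≡ u′ → v ≡ v′ →
                (p : Adj G u v) (p′ : Adj G u′ v′) → colour p ≡ colour p′
  colour-cong refl refl p p′ = trans (colour-flip p (Adj-sym p)) (sym (colour-flip p′ (Adj-sym p)))

≢-same-≡ : {a b d : Fin 2} → a ≢ d → b ≢ d → a ≡ b
≢-same-≡ {F.zero}       {F.zero}       {_}            _   _   = refl
≢-same-≡ {F.suc F.zero} {F.suc F.zero} {_}            _   _   = refl
≢-same-≡ {F.zero}       {F.suc F.zero} {F.zero}       a≢d _   = ⊥-elim (a≢d refl)
≢-same-≡ {F.zero}       {F.suc F.zero} {F.suc F.zero} _   b≢d = ⊥-elim (b≢d refl)
≢-same-≡ {F.suc F.zero} {F.zero}       {F.zero}       _   b≢d = ⊥-elim (b≢d refl)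
≢-same-≡ {F.suc F.zero} {F.zero}       {F.suc F.zero} a≢d _   = ⊥-elim (a≢d refl)

module TwoColourBridges (G : FiniteGroup) (c : EdgeColouring G 2) where
  open EdgeColours G c

  record RainbowBridge (u g v : El G) : Set where
    field
      left    : Adj G u g
      right   : Adj G g v
      rainbow : colour left ≢ colour right

  -- A rainbow path has pairwise distinct edge colours, so with two colours it
  -- has at most two edges; between distinct non-adjacent vertices, exactly two.
  rainbow-bridge : ∀ {u v} → u ≢ v → ¬ Adj G u v → RainbowPath G c u v →
                   ∃ λ g → RainbowBridge u g v
  rainbow-bridge u≢v _ ([] , _) = ⊥-elim (u≢v refl)
  rainbow-bridge _ u≁v (step p [] , _) = ⊥-elim (u≁v p)
  rainbow-bridge _ _ (step p (step q []) , _ , ((p≢q ∷ _) ∷ _)) =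
    _ , record { left = p ; right = q ; rainbow = p≢q }
  rainbow-bridge _ _ (step p (step q (step r _)) , _ , ((p≢q ∷ p≢r ∷ _) ∷ (q≢r ∷ _) ∷ _)) =
    ⊥-elim (p≢q (≢-same-≡ p≢r q≢r))

toBool : Fin 2 → Bool
toBool F.zero    = true
toBool (F.suc _) = false

toBool-≢ : {a b : Fin 2} → a ≢ b → toBool b ≡ not (toBool a)
toBool-≢ {F.zero}       {F.zero}       a≢b = ⊥-elim (a≢b refl)
toBool-≢ {F.zero}       {F.suc F.zero} _   = refl
toBool-≢ {F.suc F.zero} {F.zero}       _   = refl
toBool-≢ {F.suc F.zero} {F.suc F.zero} a≢b = ⊥-elim (a≢b refl)

module AwningFromBridges (G : FiniteGroup) (c : EdgeColouring G 2)
                         (c-rainbow : IsRainbowColouring G c)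
                         (m : ℕ) (x : Fin m → El G)
                         (ess : IsEssentialCyclicOrdering G m x) where
  open MaximalCyclicAdjacency G
  open EdgeColours G c
  open TwoColourBridges G c
  open RainbowBridge
  open ≡-Reasoning

  distinct : ∀ i j → i ≢ j → ¬ _≡C_ G (x i) (x j)
  distinct = proj₁ ess

  maximal : ∀ i → MaximalCyclic G (x i)
  maximal = proj₁ (proj₂ ess)

  bridge : ∀ {i j} → i ≢ j → ∃ λ g → RainbowBridge (x i) g (x j)
  bridge {i} {j} i≢j = rainbow-bridge x≢x x≁x (c-rainbow (x i) (x j) x≢x)
    where
    x≢x : x i ≢ x j
    x≢x = distinct-cyclic-≢ (distinct i j i≢j)
    x≁x : ¬ Adj G (x i) (x j)
    x≁x = distinct-maximal-nonadjacent (maximal i) (maximal j) (distinct i j i≢j)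

  -- h i j is the middle vertex of the bridge from x_i to x_j (irrelevant for i = j).
  h : Fin m → Fin m → El G
  h i j with i ≟ j
  ... | yes _   = FiniteGroup.ε G
  ... | no  i≢j = proj₁ (bridge i≢j)

  h-bridge : ∀ {i j} → i ≢ j → RainbowBridge (x i) (h i j) (x j)
  h-bridge {i} {j} i≢j with i ≟ j
  ... | yes i≡j  = ⊥-elim (i≢j i≡j)
  ... | no  i≢j′ = proj₂ (bridge i≢j′)

  b : ∀ {i j} → toℕ i < toℕ j → RainbowBridge (x i) (h i j) (x j)
  b i<j = h-bridge (<⇒≢ i<j)

  -- g = h i j (for some j > i) goes into A_i iff the edge x_i — g has colour 0;
  -- elements of ⟨x_i⟩ outside H_i are put into A_i arbitrarily.
  side : Fin m → El G → Bool
  side i g with any? (λ j → (toℕ i <? toℕ j) ×-dec (h i j ≟ g))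
  ... | yes (j , i<j , _) = toBool (colour (left (b i<j)))
  ... | no  _             = true

  side-h : ∀ {i j} → toℕ i < toℕ j → (p : Adj G (x i) (h i j)) → side i (h i j) ≡ toBool (colour p)
  side-h {i} {j} i<j p with any? (λ j′ → (toℕ i <? toℕ j′) ×-dec (h i j′ ≟ h i j))
  ... | yes (j′ , i<j′ , h≡h) = cong toBool (colour-cong refl h≡h _ p)
  ... | no  ∄j                = ⊥-elim (∄j (j , i<j , refl))

  -- Conditions (a)/(b): h j s = h i j forces opposite sides, because the edge
  -- x_j — h j s is the edge h i j — x_j of the bridge from x_i to x_j.
  side-flip : ∀ {i j s} (i<j : toℕ i < toℕ j) (j<s : toℕ j < toℕ s) →
              h j s ≡ h i j → side j (h j s) ≡ not (side i (h i j))
  side-flip {i} {j} i<j j<s h≡h = begin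
    side _ _                                   ≡⟨ side-h j<s (left (b j<s)) ⟩
    toBool (colour (left (b j<s)))             ≡⟨ cong toBool (colour-cong refl h≡h _ (Adj-sym q)) ⟩
    toBool (colour (Adj-sym q))                ≡⟨ cong toBool (sym (colour-flip q _)) ⟩
    toBool (colour q)                          ≡⟨ toBool-≢ (rainbow (b i<j)) ⟩
    not (toBool (colour (left (b i<j))))       ≡⟨ cong not (sym (side-h i<j _)) ⟩
    not (side _ _)                             ∎
    where
    q : Adj G (h i j) (x j)
    q = right (b i<j)

  -- Conditions (c)/(d): h j r = h i r forces equal sides, because both edges
  -- x_i — g and x_j — g differ in colour from the common edge g — x_r.
  side-agree : ∀ {i j r} (i<j : toℕ i < toℕ j) (j<r : toℕ j < toℕ r) →
               h j r ≡ h i r → side j (h j r) ≡ side i (h i r)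
  side-agree {i} {r = r} i<j j<r h≡h = begin
    side _ _                        ≡⟨ side-h j<r _ ⟩
    toBool (colour (left (b j<r)))  ≡⟨ cong toBool (≢-same-≡ jr≢ir (rainbow (b i<r))) ⟩
    toBool (colour (left (b i<r)))  ≡⟨ sym (side-h i<r _) ⟩
    side _ _                        ∎
    where
    i<r : toℕ i < toℕ r
    i<r = <-trans i<j j<r
    same-right : colour (right (b j<r)) ≡ colour (right (b i<r))
    same-right = colour-cong h≡h refl _ _
    jr≢ir : colour (left (b j<r)) ≢ colour (right (b i<r))
    jr≢ir eq = rainbow (b j<r) (trans eq (sym same-right))

  awning : Awning G m x
  awning = record
    { h      = h
    ; side   = side
    ; cond1  = λ i j i<j → neighbour-∈ (maximal i) (left (b i<j))
                         , neighbour-∈ (maximal j) (Adj-sym (right (b i<j)))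
    ; cond2a = λ i j s i<j j<s h≡h sideA → trans (side-flip i<j j<s h≡h) (cong not sideA)
    ; cond2b = λ i j s i<j j<s h≡h sideB → trans (side-flip i<j j<s h≡h) (cong not sideB)
    ; cond2c = λ i j r i<j j<r h≡h sideA → trans (side-agree i<j j<r h≡h) sideA
    ; cond2d = λ i j r i<j j<r h≡h sideB → trans (side-agree i<j j<r h≡h) sideB
    }

proposition2p15 : (G : FiniteGroup) → rcEq G 2 →
    ∀ (m : ℕ) (x : Fin m → El G) → IsEssentialCyclicOrdering G m x → Awning G m x
proposition2p15 G ((c , c-rainbow) , _) m x ess = AwningFromBridges.awning G c c-rainbow m x ess
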